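{- A vine $\mathcal{P}$ is an LR-vine if and only if $\mathcal{P}$ satisfies the proximity condition: for any distinct elements $a,b\in\mathcal{P}_i$ with $i\ge2$, if $a$ and $b$ are covered by a common element, then $a$ and $b$ cover a common element.
   Context: Posets are finite. A poset $\mathcal{P}$ is graded with rank function $\operatorname{rk}\colon\mathcal{P}\to\mathbb{Z}_{>0}$ if $x<y$ implies $\operatorname{rk}(x)<\operatorname{rk}(y)$, $\operatorname{rk}(y)=\operatorname{rk}(x)+1$ whenever $y$ covers $x$, and all minimal elements have rank $1$. $\mathcal{P}_i$ is the set of elements of rank $i$, $\operatorname{rk}(\mathcal{P})$ the maximal rank, $\dim(\mathcal{P})$ the number of minimal elements, $\mathcal{E}(v)$ the set of elements covered by $v$. A vine is a finite graded poset such that (1) every non-minimal element covers exactly two elements, and any two distinct elements of the same rank are covered by at most one common element; (2) for each $1\le i\le\operatorname{rk}(\mathcal{P})$ the graph $F_i$ with vertex set $\mathcal{P}_i$ and edge set $\{\mathcal{E}(v)\mid v\in\mathcal{P}_{i+1}\}$ is a forest. An R-vine is a vine with $\operatorname{rk}(\mathcal{P})=\dim(\mathcal{P})$, each $F_i$ a tree, and satisfying the proximity condition. An LR-vine is a vine such that every principal ideal $\mathcal{P}_{\le v}=\{x\mid x\le v\}$, with induced order and rank, is an R-vine. -}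

module Defs where

open import Data.Nat using (ℕ; zero; suc; _≤_; _<_)
open import Data.Fin using (Fin)
open import Data.Product using (Σ; ∃; ∃-syntax; _×_; _,_)
open import Data.Sum using (_⊎_)
open import Data.Unit using (⊤)
open import Data.Empty using (⊥)
open import Data.List using (List; length)
open import Data.List.Membership.Propositional using (_∈_)
open import Data.List.Relation.Unary.Unique.Propositional using (Unique)
open import Relation.Nullary using (¬_)
open import Relation.Binary using (IsPartialOrder)
open import Relation.Binary.PropositionalEquality using (_≡_; _≢_)
open import Function.Bundles using (_⇔_)

record FinPoset : Set₁ where
  field
    size           : ℕ
    _≼_            : Fin size → Fin size → Set
    isPartialOrder : IsPartialOrder _≡_ _≼_

-- Everything below is relative to a poset P, a candidate rank function rk,
-- and a subset S of the carrier (the induced subposet on S, with the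
-- induced order and the restricted rank function).
module _ (P : FinPoset) (rk : Fin (FinPoset.size P) → ℕ) where
  open FinPoset P

  El : Set
  El = Fin size

  Subset : Set₁
  Subset = El → Set

  _≺_ : El → El → Set
  x ≺ y = (x ≼ y) × (x ≢ y)

  Covers : Subset → El → El → Set
  Covers S y x = S x × S y × x ≺ y × (∀ z → S z → x ≺ z → z ≺ y → ⊥)

  Minimal : Subset → El → Set
  Minimal S x = S x × (∀ y → S y → y ≺ x → ⊥)

  IsGraded : Subset → Set
  IsGraded S =
      (∀ x → S x → 1 ≤ rk x)
    × (∀ x y → S x → S y → x ≺ y → rk x < rk y)
    × (∀ x y → Covers S y x → rk y ≡ suc (rk x))
    × (∀ x → Minimal S x → rk x ≡ 1)

  -- r is the maximal rank rk(S)  (0 for the empty poset)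
  MaxRank : Subset → ℕ → Set
  MaxRank S r = (∀ x → S x → rk x ≤ r) × ((r ≡ 0) ⊎ (∃[ x ] (S x × rk x ≡ r)))

  Dim : Subset → ℕ → Set
  Dim S d = ∃[ xs ] (Unique xs × (∀ x → (x ∈ xs) ⇔ Minimal S x) × length xs ≡ d)

  VineCond1 : Subset → Set
  VineCond1 S =
      (∀ v → S v → ¬ Minimal S v →
         ∃[ a ] ∃[ b ] (a ≢ b × Covers S v a × Covers S v b
                        × (∀ c → Covers S v c → (c ≡ a) ⊎ (c ≡ b))))
    × (∀ a b → S a → S b → a ≢ b → rk a ≡ rk b →
         ∀ v w → Covers S v a → Covers S v b → Covers S w a → Covers S w b → v ≡ w)

  -- the graph F_i: vertices = elements of S of rank i,
  -- edges = elements v of S of rank i+1, with endpoints E(v)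
  Vertex : Subset → ℕ → El → Set
  Vertex S i x = S x × rk x ≡ i

  Edge : Subset → ℕ → El → Set
  Edge S i v = S v × rk v ≡ suc i

  Cycle : Subset → ℕ → Set
  Cycle S i = Σ ℕ λ k → Σ (ℕ → El) λ xs → Σ (ℕ → El) λ vs →
      2 ≤ k
    × xs k ≡ xs 0
    × (∀ j → j < k → Vertex S i (xs j) × Edge S i (vs j)
                   × Covers S (vs j) (xs j) × Covers S (vs j) (xs (suc j)))
    × (∀ j j′ → j < k → j′ < k → xs j ≡ xs j′ → j ≡ j′)
    × (∀ j j′ → j < k → j′ < k → vs j ≡ vs j′ → j ≡ j′)

  Forest : Subset → ℕ → Set
  Forest S i = ¬ Cycle S i

  Adjacent : Subset → ℕ → El → El → Set
  Adjacent S i a b = ∃[ v ] (Edge S i v × Covers S v a × Covers S v b)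

  Connected : Subset → ℕ → Set
  Connected S i = ∀ x y → Vertex S i x → Vertex S i y →
    Σ ℕ λ k → Σ (ℕ → El) λ xs →
      xs 0 ≡ x × xs k ≡ y × (∀ j → j < k → Adjacent S i (xs j) (xs (suc j)))

  Tree : Subset → ℕ → Set
  Tree S i = Forest S i × Connected S i

  IsVine : Subset → Set
  IsVine S = IsGraded S × VineCond1 S
    × (∀ r → MaxRank S r → ∀ i → 1 ≤ i → i ≤ r → Forest S i)

  Proximity : Subset → Set
  Proximity S = ∀ a b → S a → S b → a ≢ b → rk a ≡ rk b → 2 ≤ rk a →
    (∃[ v ] (Covers S v a × Covers S v b)) →
    ∃[ w ] (Covers S a w × Covers S b w)

  IsRVine : Subset → Set
  IsRVine S = IsVine S
    × (Σ ℕ λ r → MaxRank S r × Dim S r × (∀ i → 1 ≤ i → i ≤ r → Tree S i))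
    × Proximity S

  Whole : Subset
  Whole _ = ⊤

  Ideal : El → Subset
  Ideal v x = x ≼ v

  IsLRVine : Set
  IsLRVine = ∀ v → IsRVine (Ideal v)

-- An LR-vine has proximity because a common cover v of a and b puts both in the R-vine P≤v.
-- Conversely, every principal ideal P≤v of a vine inherits gradedness, condition (1), the
-- forest property and proximity, so what remains is that each level of P≤v is connected and
-- that P≤v has exactly rk v minimal elements (leaves). Both go by induction on rk v through the
-- two elements a, b covered by v and, by proximity, a common child w of a and b: elements below
-- a and below b are joined through elements below w, and the leaves below v number
-- |L(a)| + |L(b)| − |L(a) ∩ L(b)| where L(a) ∩ L(b) = L(w). The last equation holds because a
-- leaf below both ends of a path in a forest F_i lies below all of its vertices: proximity lowers
-- the path, rank by rank, to a path whose vertices lie below those of the original.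

module Submission where

open import Level using (Level; 0ℓ)
open import Data.Nat using (ℕ; zero; suc; _+_; _≤_; _<_; _≤?_; _≟_; z≤n; s≤s)
open import Data.Nat.Properties
  using ( ≤-refl; ≤-trans; <-trans; ≤-pred; <⇒≤; <⇒≱; ≰⇒>; ≤∧≢⇒<; <-irrefl; ≤-antisym
        ; +-suc; +-monoʳ-≤; +-cancelʳ-≡; m≤m+n; suc-injective; ≤-totalOrder; module ≤-Reasoning)
open import Data.Nat.Induction using (<-wellFounded)
open import Data.Fin using (Fin)
open import Data.Fin.Properties using () renaming (_≟_ to _≟ᶠ_)
open import Data.Product using (Σ; ∃-syntax; _×_; _,_; proj₁; proj₂)
open import Data.Sum using (_⊎_; inj₁; inj₂; [_,_]; [_,_]′)
open import Data.Unit using (tt)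
open import Data.Empty using (⊥-elim)
open import Data.List using (List; []; _∷_; _++_; length; filter; allFin)
open import Data.List.Properties using (filter-≐; filter-none; filter-accept; filter-reject)
open import Data.List.Extrema ≤-totalOrder using (argmax; f[xs]≤f[argmax])
open import Data.List.Membership.Propositional using (_∈_; _∉_)
open import Data.List.Membership.Propositional.Properties using (∈-allFin; ∈-filter⁺; ∈-filter⁻)
open import Data.List.Relation.Unary.Any using (Any; here; there)
open import Data.List.Relation.Unary.All using (All; []; _∷_; lookupAny)
import Data.List.Relation.Unary.All as All
open import Data.List.Relation.Unary.All.Properties using (¬Any⇒All¬; ++⁺)
open import Data.List.Relation.Unary.AllPairs using ([]; _∷_)
open import Data.List.Relation.Unary.Unique.Propositional using (Unique)
open import Data.List.Relation.Unary.Unique.Propositional.Properties using (allFin⁺; filter⁺)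
open import Data.List.Relation.Binary.Sublist.Propositional using ([]; _∷_; _∷ʳ_; minimum) renaming (_⊆_ to _⊑_)
open import Data.List.Relation.Binary.Sublist.Propositional.Properties using (All-resp-⊆)
open import Function using (_∘_)
open import Function.Bundles using (_⇔_; mk⇔; Equivalence)
open import Induction.WellFounded using (module All)
open import Relation.Binary using (IsPartialOrder; DecidableEquality)
import Relation.Binary.Construct.On as On
open import Relation.Binary.PropositionalEquality using (_≡_; _≢_; refl; sym; trans; cong; cong₂; subst; module ≡-Reasoning)
open import Relation.Nullary using (¬_; Dec; yes; no; contradiction)
open import Relation.Nullary.Decidable using (_×-dec_; ¬¬-excluded-middle)
open import Relation.Unary using (Pred; Decidable; _≐_)
open import Relation.Unary.Properties using (_∪?_; _∩?_)

open import Defs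

module _ {a : Level} {A : Set a} where

  count : ∀ {ℓ} {Q : Pred A ℓ} → Decidable Q → List A → ℕ
  count Q? xs = length (filter Q? xs)

  count-≐ : ∀ {ℓ ℓ′} {Q : Pred A ℓ} {R : Pred A ℓ′} (Q? : Decidable Q) (R? : Decidable R) → Q ≐ R →
            ∀ xs → count Q? xs ≡ count R? xs
  count-≐ Q? R? Q≐R xs = cong length (filter-≐ Q? R? Q≐R xs)

  count-none : ∀ {ℓ} {Q : Pred A ℓ} (Q? : Decidable Q) → (∀ x → ¬ Q x) → ∀ xs → count Q? xs ≡ 0
  count-none Q? ¬Q xs = cong length (filter-none Q? (All.universal ¬Q xs))

  count-∪+count-∩ : ∀ {ℓ ℓ′} {Q : Pred A ℓ} {R : Pred A ℓ′} (Q? : Decidable Q) (R? : Decidable R) →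
    ∀ xs → count (Q? ∪? R?) xs + count (Q? ∩? R?) xs ≡ count Q? xs + count R? xs
  count-∪+count-∩ Q? R? [] = refl
  count-∪+count-∩ Q? R? (x ∷ xs) with Q? x | R? x | count-∪+count-∩ Q? R? xs
  ... | yes _ | yes _ | ih = cong suc (trans (+-suc _ _) (trans (cong suc ih) (sym (+-suc _ _))))
  ... | yes _ | no _  | ih = cong suc ih
  ... | no _  | yes _ | ih = trans (cong suc ih) (sym (+-suc _ _))
  ... | no _  | no _  | ih = ih

  count-≟-unique : (_≟ᴬ_ : DecidableEquality A) {xs : List A} {y : A} →
                   Unique xs → y ∈ xs → count (_≟ᴬ y) xs ≡ 1
  count-≟-unique _≟ᴬ_ (x≢xs ∷ _) (here refl) =
    trans (cong length (filter-accept (_≟ᴬ _) refl))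
          (cong (suc ∘ length) (filter-none (_≟ᴬ _) (All.map (_∘ sym) x≢xs)))
  count-≟-unique _≟ᴬ_ (x≢xs ∷ u) (there y∈xs) =
    trans (cong length (filter-reject (_≟ᴬ _) (All.lookup x≢xs y∈xs)))
          (count-≟-unique _≟ᴬ_ u y∈xs)

  at : A → List A → ℕ → A
  at d []       _       = d
  at d (x ∷ xs) zero    = x
  at d (x ∷ xs) (suc j) = at d xs j

  at-length : ∀ d xs → at d xs (length xs) ≡ d
  at-length d []       = refl
  at-length d (x ∷ xs) = at-length d xs

  at-∈ : ∀ d {xs} j → j < length xs → at d xs j ∈ xs
  at-∈ d {x ∷ xs} zero    _         = here refl
  at-∈ d {x ∷ xs} (suc j) (s≤s j<n) = there (at-∈ d j j<n)

  at-injective : ∀ d {xs} → Unique xs → ∀ j k → j < length xs → k < length xs →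
                 at d xs j ≡ at d xs k → j ≡ k
  at-injective d _          zero    zero    _         _         _ = refl
  at-injective d (x≢xs ∷ _) zero    (suc k) _         (s≤s k<n) e = ⊥-elim (All.lookup x≢xs (at-∈ d k k<n) e)
  at-injective d (x≢xs ∷ _) (suc j) zero    (s≤s j<n) _         e = ⊥-elim (All.lookup x≢xs (at-∈ d j j<n) (sym e))
  at-injective d (_ ∷ u)    (suc j) (suc k) (s≤s j<n) (s≤s k<n) e = cong suc (at-injective d u j k j<n k<n e)

  Unique-resp-⊑ : {xs ys : List A} → xs ⊑ ys → Unique ys → Unique xs
  Unique-resp-⊑ []             []         = []
  Unique-resp-⊑ (_ ∷ʳ xs⊑ys)   (_ ∷ u)    = Unique-resp-⊑ xs⊑ys u
  Unique-resp-⊑ (refl ∷ xs⊑ys) (y≢ys ∷ u) = All-resp-⊆ xs⊑ys y≢ys ∷ Unique-resp-⊑ xs⊑ys u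

module Ideals (P : FinPoset) (rk : Fin (FinPoset.size P) → ℕ) where
  open FinPoset P
  open IsPartialOrder isPartialOrder using () renaming (trans to ≼-trans)

  W : Subset P rk
  W = Whole P rk

  covers-ideal⇒covers : ∀ {v y x} → Covers P rk (Ideal P rk v) y x → Covers P rk W y x
  covers-ideal⇒covers (_ , y≼v , x≺y , between) =
    tt , tt , x≺y , λ z _ x≺z z≺y → between z (≼-trans (proj₁ z≺y) y≼v) x≺z z≺y

  covers⇒covers-ideal : ∀ {v y x} → y ≼ v → Covers P rk W y x → Covers P rk (Ideal P rk v) y x
  covers⇒covers-ideal y≼v (_ , _ , x≺y , between) =
    ≼-trans (proj₁ x≺y) y≼v , y≼v , x≺y , λ z _ → between z tt

  minimal-ideal⇒minimal : ∀ {v x} → Minimal P rk (Ideal P rk v) x → Minimal P rk W x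
  minimal-ideal⇒minimal (x≼v , nothing-below) =
    tt , λ y _ y≺x → nothing-below y (≼-trans (proj₁ y≺x) x≼v) y≺x

  minimal⇒minimal-ideal : ∀ {v x} → x ≼ v → Minimal P rk W x → Minimal P rk (Ideal P rk v) x
  minimal⇒minimal-ideal x≼v (_ , nothing-below) = x≼v , λ y _ → nothing-below y tt

  graded-ideal : IsGraded P rk W → ∀ v → IsGraded P rk (Ideal P rk v)
  graded-ideal (positive , monotone , cover-step , minimal-one) v =
      (λ x _ → positive x tt)
    , (λ x y _ _ → monotone x y tt tt)
    , (λ x y → cover-step x y ∘ covers-ideal⇒covers)
    , (λ x → minimal-one x ∘ minimal-ideal⇒minimal)

  vineCond1-ideal : VineCond1 P rk W → ∀ v → VineCond1 P rk (Ideal P rk v)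
  vineCond1-ideal (two-children , one-common-cover) v =
      (λ u u≼v ¬min →
         let (a , b , a≢b , u⋗a , u⋗b , only-a-b) = two-children u tt (¬min ∘ minimal⇒minimal-ideal u≼v)
         in a , b , a≢b , covers⇒covers-ideal u≼v u⋗a , covers⇒covers-ideal u≼v u⋗b
              , λ c → only-a-b c ∘ covers-ideal⇒covers)
    , λ a b _ _ a≢b rk≡ u w u⋗a u⋗b w⋗a w⋗b →
        one-common-cover a b tt tt a≢b rk≡ u w (covers-ideal⇒covers u⋗a) (covers-ideal⇒covers u⋗b)
                                               (covers-ideal⇒covers w⋗a) (covers-ideal⇒covers w⋗b)

  cycle-ideal⇒cycle : ∀ {v i} → Cycle P rk (Ideal P rk v) i → Cycle P rk W i
  cycle-ideal⇒cycle (k , xs , vs , 2≤k , closed , steps , xs-inj , vs-inj) =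
    k , xs , vs , 2≤k , closed , step , xs-inj , vs-inj
    where
    step = λ j j<k → let ((_ , rk-x) , (_ , rk-v) , v⋗x , v⋗x′) = steps j j<k
                     in (tt , rk-x) , (tt , rk-v) , covers-ideal⇒covers v⋗x , covers-ideal⇒covers v⋗x′

  proximity-ideal : Proximity P rk W → ∀ v → Proximity P rk (Ideal P rk v)
  proximity-ideal proximity v a b a≼v b≼v a≢b rk≡ 2≤rk (u , u⋗a , u⋗b) =
    let (w , a⋗w , b⋗w) = proximity a b tt tt a≢b rk≡ 2≤rk (u , covers-ideal⇒covers u⋗a , covers-ideal⇒covers u⋗b)
    in w , covers⇒covers-ideal a≼v a⋗w , covers⇒covers-ideal b≼v b⋗w

  LRVine⇒proximity : IsLRVine P rk → Proximity P rk W
  LRVine⇒proximity lr a b _ _ a≢b rk≡ 2≤rk (v , v⋗a@(_ , _ , (a≼v , _) , _) , v⋗b@(_ , _ , (b≼v , _) , _)) =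
    let (w , a⋗w , b⋗w) = proj₂ (proj₂ (lr v)) a b a≼v b≼v a≢b rk≡ 2≤rk
                            (v , covers⇒covers-ideal v≼v v⋗a , covers⇒covers-ideal v≼v v⋗b)
    in w , covers-ideal⇒covers a⋗w , covers-ideal⇒covers b⋗w
    where v≼v = IsPartialOrder.refl isPartialOrder

module Graded (P : FinPoset) (rk : Fin (FinPoset.size P) → ℕ) (graded : IsGraded P rk (Whole P rk)) where
  open FinPoset P public
  open IsPartialOrder isPartialOrder public using () renaming (refl to ≼-refl; trans to ≼-trans)
  open Ideals P rk public

  infix 4 _⊏_ _⋗_

  _⊏_ : El P rk → El P rk → Set
  _⊏_ = _≺_ P rk

  _⋗_ : El P rk → El P rk → Set
  v ⋗ x = Covers P rk W v x

  private variable
    x y z u v : El P rk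

  rank-positive : ∀ x → 1 ≤ rk x
  rank-positive x = proj₁ graded x tt

  rank-mono : x ⊏ y → rk x < rk y
  rank-mono x⊏y = proj₁ (proj₂ graded) _ _ tt tt x⊏y

  rank-cover : v ⋗ x → rk v ≡ suc (rk x)
  rank-cover v⋗x = proj₁ (proj₂ (proj₂ graded)) _ _ v⋗x

  rank-minimal : Minimal P rk W x → rk x ≡ 1
  rank-minimal min = proj₂ (proj₂ (proj₂ graded)) _ min

  cover⇒⊏ : v ⋗ x → x ⊏ v
  cover⇒⊏ (_ , _ , x⊏v , _) = x⊏v

  cover⇒≼ : v ⋗ x → x ≼ v
  cover⇒≼ = proj₁ ∘ cover⇒⊏

  cover⇒rank< : v ⋗ x → rk x < rk v
  cover⇒rank< = rank-mono ∘ cover⇒⊏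

  rank-siblings : v ⋗ x → v ⋗ y → rk x ≡ rk y
  rank-siblings v⋗x v⋗y = suc-injective (trans (sym (rank-cover v⋗x)) (rank-cover v⋗y))

  ≼⇒rank≤ : x ≼ y → rk x ≤ rk y
  ≼⇒rank≤ {x} {y} x≼y with x ≟ᶠ y
  ... | yes refl = ≤-refl
  ... | no x≢y   = <⇒≤ (rank-mono (x≼y , x≢y))

  ≼∧rank≡⇒≡ : x ≼ y → rk x ≡ rk y → x ≡ y
  ≼∧rank≡⇒≡ {x} {y} x≼y rk≡ with x ≟ᶠ y
  ... | yes x≡y = x≡y
  ... | no x≢y  = contradiction rk≡ (λ e → <-irrefl e (rank-mono (x≼y , x≢y)))

  ⊏∧cover⇒rank≤ : x ⊏ y → y ⋗ z → rk x ≤ rk z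
  ⊏∧cover⇒rank≤ {x} x⊏y y⋗z = ≤-pred (subst (rk x <_) (rank-cover y⋗z) (rank-mono x⊏y))

  ⊏⇒2≤rank : x ⊏ y → 2 ≤ rk y
  ⊏⇒2≤rank {x} x⊏y = ≤-trans (s≤s (rank-positive x)) (rank-mono x⊏y)

  leaf⊏ : rk x ≡ 1 → 2 ≤ rk y → x ≼ y → x ⊏ y
  leaf⊏ rk≡1 2≤rk x≼y = x≼y , λ { refl → <-irrefl (sym rk≡1) 2≤rk }

  rank-one-or-more : ∀ x → rk x ≡ 1 ⊎ 2 ≤ rk x
  rank-one-or-more x with rk x ≤? 1
  ... | yes rk≤1 = inj₁ (≤-antisym rk≤1 (rank-positive x))
  ... | no rk≰1  = inj₂ (≰⇒> rk≰1)

  maxRank-ideal : ∀ v → MaxRank P rk (Ideal P rk v) (rk v)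
  maxRank-ideal v = (λ _ → ≼⇒rank≤) , inj₂ (v , ≼-refl , refl)

  rank-rec : (Q : El P rk → Set) → (∀ v → (∀ {u} → rk u < rk v → Q u) → Q v) → ∀ v → Q v
  rank-rec = All.wfRec (On.wellFounded rk <-wellFounded) 0ℓ

  -- Walks in the graph F_i, where i is the rank of the endpoints.
  data Walk : El P rk → El P rk → Set where
    []   : Walk x x
    step : ∀ e → x ≢ y → e ⋗ x → e ⋗ y → Walk y z → Walk x z

  edges : Walk x y → List (El P rk)
  edges []               = []
  edges (step e _ _ _ r) = e ∷ edges r

  sources : Walk x y → List (El P rk)
  sources []                       = []
  sources (step {x = x} _ _ _ _ r) = x ∷ sources r

  vertices : Walk x y → List (El P rk)
  vertices {x} []                   = x ∷ []
  vertices (step {x = x} _ _ _ _ r) = x ∷ vertices r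

  _++ᵂ_ : Walk x y → Walk y z → Walk x z
  []             ++ᵂ V = V
  step e n a b r ++ᵂ V = step e n a b (r ++ᵂ V)

  edges-++ᵂ : (U : Walk x y) (V : Walk y z) → edges (U ++ᵂ V) ≡ edges U ++ edges V
  edges-++ᵂ []               V = refl
  edges-++ᵂ (step e _ _ _ r) V = cong (e ∷_) (edges-++ᵂ r V)

  Any-start : {Q : Pred (El P rk) 0ℓ} (V : Walk x y) → Q x → Any Q (vertices V)
  Any-start []               qx = here qx
  Any-start (step _ _ _ _ _) qx = here qx

  end∈vertices : (V : Walk x y) → y ∈ vertices V
  end∈vertices []               = here refl
  end∈vertices (step _ _ _ _ r) = there (end∈vertices r)

  walk-rank : Walk x y → rk y ≡ rk x
  walk-rank []                   = refl
  walk-rank (step _ _ e⋗x e⋗y r) = trans (walk-rank r) (sym (rank-siblings e⋗x e⋗y))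

  length-sources : (V : Walk x y) → length (sources V) ≡ length (edges V)
  length-sources []               = refl
  length-sources (step _ _ _ _ r) = cong suc (length-sources r)

  -- Beyond the last step, vertexAt returns the end point of the walk.
  vertexAt : Walk x y → ℕ → El P rk
  vertexAt {y = y} V = at y (sources V)

  edgeAt : Walk x y → ℕ → El P rk
  edgeAt {y = y} V = at y (edges V)

  vertexAt-start : (V : Walk x y) → vertexAt V 0 ≡ x
  vertexAt-start []               = refl
  vertexAt-start (step _ _ _ _ _) = refl

  vertexAt-end : (V : Walk x y) → vertexAt V (length (edges V)) ≡ y
  vertexAt-end {y = y} V = subst (λ n → at y (sources V) n ≡ y) (length-sources V) (at-length y (sources V))

  vertexAt-rank : (V : Walk x y) → ∀ j → rk (vertexAt V j) ≡ rk x
  vertexAt-rank []                   j       = refl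
  vertexAt-rank (step _ _ _ _ _)     zero    = refl
  vertexAt-rank (step _ _ e⋗x e⋗y r) (suc j) = trans (vertexAt-rank r j) (sym (rank-siblings e⋗x e⋗y))

  edgeAt-covers : (V : Walk x y) → ∀ j → j < length (edges V) →
                  edgeAt V j ⋗ vertexAt V j × edgeAt V j ⋗ vertexAt V (suc j)
  edgeAt-covers (step e _ e⋗x e⋗y r) zero    _         = e⋗x , subst (e ⋗_) (sym (vertexAt-start r)) e⋗y
  edgeAt-covers (step _ _ _ _ r)     (suc j) (s≤s j<n) = edgeAt-covers r j j<n

  WalkBelow : El P rk → El P rk → El P rk → Set
  WalkBelow v x y = Σ (Walk x y) λ V → All (_≼ v) (edges V)

  WalkBelow-mono : u ≼ v → WalkBelow u x y → WalkBelow v x y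
  WalkBelow-mono u≼v (V , below-u) = V , All.map (λ e≼u → ≼-trans e≼u u≼v) below-u

  _++ᴮ_ : WalkBelow v x y → WalkBelow v y z → WalkBelow v x z
  (U , below-U) ++ᴮ (V , below-V) = U ++ᵂ V , subst (All (_≼ _)) (sym (edges-++ᵂ U V)) (++⁺ below-U below-V)

  adjacent-along : (V : Walk x y) → All (_≼ v) (edges V) → ∀ j → j < length (edges V) →
                   Adjacent P rk (Ideal P rk v) (rk x) (vertexAt V j) (vertexAt V (suc j))
  adjacent-along V V≼v j j<k =
    let (e⋗x , e⋗x′) = edgeAt-covers V j j<k
        e≼v = All.lookup V≼v (at-∈ _ j j<k)
    in edgeAt V j , (e≼v , trans (rank-cover e⋗x) (cong suc (vertexAt-rank V j)))
     , covers⇒covers-ideal e≼v e⋗x , covers⇒covers-ideal e≼v e⋗x′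

  path-between-equals : (V : Walk x y) → x ≡ y → Unique (vertices V) → vertices V ≡ x ∷ []
  path-between-equals []               _    _         = refl
  path-between-equals (step _ _ _ _ r) refl (x≢r ∷ _) = ⊥-elim (All.lookup x≢r (end∈vertices r) refl)

  closed-walk⇒cycle : (C : Walk x x) → Unique (sources C) → Unique (edges C) → 2 ≤ length (edges C) →
                      Cycle P rk W (rk x)
  closed-walk⇒cycle {x} C unique-sources unique-edges 2≤k =
      length (edges C) , vertexAt C , edgeAt C , 2≤k
    , trans (vertexAt-end C) (sym (vertexAt-start C))
    , (λ j j<k → let (e⋗x , e⋗x′) = edgeAt-covers C j j<k in
         (tt , vertexAt-rank C j) , (tt , trans (rank-cover e⋗x) (cong suc (vertexAt-rank C j))) , e⋗x , e⋗x′)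
    , (λ j k j< k< → at-injective x unique-sources j k (in-sources j<) (in-sources k<))
    , at-injective x unique-edges
    where
    in-sources : ∀ {j} → j < length (edges C) → j < length (sources C)
    in-sources = subst (_ <_) (sym (length-sources C))

  prefix : (V : Walk x y) → z ∈ vertices V → Walk x z
  prefix []               (here refl) = []
  prefix (step _ _ _ _ _) (here refl) = []
  prefix (step e n a b r) (there z∈r) = step e n a b (prefix r z∈r)

  prefix-edges : (V : Walk x y) (z∈V : z ∈ vertices V) → edges (prefix V z∈V) ⊑ edges V
  prefix-edges []               (here refl) = []
  prefix-edges (step _ _ _ _ _) (here refl) = minimum _
  prefix-edges (step _ _ _ _ r) (there z∈r) = refl ∷ prefix-edges r z∈r

  prefix-sources : (V : Walk x y) (z∈V : z ∈ vertices V) → sources (prefix V z∈V) ⊑ vertices V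
  prefix-sources []               (here refl) = minimum _
  prefix-sources (step _ _ _ _ _) (here refl) = minimum _
  prefix-sources (step _ _ _ _ r) (there z∈r) = refl ∷ prefix-sources r z∈r

  end∉sources-prefix : (V : Walk x y) → Unique (vertices V) → (z∈V : z ∈ vertices V) → z ∉ sources (prefix V z∈V)
  end∉sources-prefix []               _            (here refl) ()
  end∉sources-prefix (step _ _ _ _ _) _            (here refl) ()
  end∉sources-prefix (step _ _ _ _ r) (x≢r ∷ _)    (there z∈r) (here z≡x)  = All.lookup x≢r z∈r (sym z≡x)
  end∉sources-prefix (step _ _ _ _ r) (_ ∷ unique) (there z∈r) (there z∈p) = end∉sources-prefix r unique z∈r z∈p

  nonempty-walk : (V : Walk x y) → x ≢ y → 1 ≤ length (edges V)
  nonempty-walk []               x≢x = contradiction refl x≢x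
  nonempty-walk (step _ _ _ _ _) _   = s≤s z≤n

module Vine (P : FinPoset) (rk : Fin (FinPoset.size P) → ℕ) (vine : IsVine P rk (Whole P rk)) where
  open Graded P rk (proj₁ vine) public
  open import Data.List.Membership.DecPropositional (_≟ᶠ_ {size}) using (_∈?_)

  private variable
    a b c d s t x y z u v w : El P rk

  Children : El P rk → Set
  Children v = ∃[ a ] ∃[ b ] (a ≢ b × v ⋗ a × v ⋗ b × (∀ c → v ⋗ c → c ≡ a ⊎ c ≡ b))

  children : 2 ≤ rk v → Children v
  children {v} 2≤rk = proj₁ (proj₁ (proj₂ vine)) v tt λ min → <-irrefl (sym (rank-minimal min)) 2≤rk

  at-most-one-common-cover : a ≢ b → rk a ≡ rk b → v ⋗ a → v ⋗ b → w ⋗ a → w ⋗ b → v ≡ w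
  at-most-one-common-cover a≢b rk≡ = proj₂ (proj₁ (proj₂ vine)) _ _ tt tt a≢b rk≡ _ _

  -- The order is not assumed decidable, so a child of v above x is at first only found up to
  -- double negation, by climbing from x; decidability of ≼, and with it below-child, follows.
  ¬¬below-child : x ⊏ v → ¬ ¬ (∃[ c ] (v ⋗ c × x ≼ c))
  ¬¬below-child {x} {v} = go (rk v) (m≤m+n (rk v) (rk x))
    where
    narrower : ∀ n {x z} → rk v ≤ suc n + rk x → x ⊏ z → rk v ≤ n + rk z
    narrower n {x} {z} gap x⊏z = begin
      rk v            ≤⟨ gap ⟩
      suc n + rk x    ≡⟨ sym (+-suc n (rk x)) ⟩
      n + suc (rk x)  ≤⟨ +-monoʳ-≤ n (rank-mono x⊏z) ⟩
      n + rk z        ∎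
      where open ≤-Reasoning

    go : ∀ n {x} → rk v ≤ n + rk x → x ⊏ v → ¬ ¬ (∃[ c ] (v ⋗ c × x ≼ c))
    go zero    gap x⊏v _ = <⇒≱ (rank-mono x⊏v) gap
    go (suc n) {x} gap x⊏v no-child = ¬¬-excluded-middle {A = ∃[ z ] (x ⊏ z × z ⊏ v)} λ where
      (yes (z , x⊏z , z⊏v)) →
        go n (narrower n gap x⊏z) z⊏v λ (c , v⋗c , z≼c) → no-child (c , v⋗c , ≼-trans (proj₁ x⊏z) z≼c)
      (no nothing-between) →
        no-child (x , (tt , tt , x⊏v , λ z _ x⊏z z⊏v → nothing-between (z , x⊏z , z⊏v)) , ≼-refl)

  ¬¬below-either-child : (∀ c → v ⋗ c → c ≡ a ⊎ c ≡ b) → x ⊏ v → ¬ ¬ (x ≼ a ⊎ x ≼ b)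
  ¬¬below-either-child only-a-b x⊏v no-child =
    ¬¬below-child x⊏v λ (c , v⋗c , x≼c) →
      no-child ([ (λ { refl → inj₁ x≼c }) , (λ { refl → inj₂ x≼c }) ] (only-a-b c v⋗c))

  infix 4 _≼?_

  _≼?_ : ∀ x v → Dec (x ≼ v)
  x ≼? v = rank-rec (λ v → Dec (x ≼ v)) decide v
    where
    decide : ∀ v → (∀ {u} → rk u < rk v → Dec (x ≼ u)) → Dec (x ≼ v)
    decide v below? with x ≟ᶠ v | rank-one-or-more v
    ... | yes refl | _         = yes ≼-refl
    ... | no x≢v   | inj₁ rk≡1 = no λ x≼v → <⇒≱ (subst (rk x <_) rk≡1 (rank-mono (x≼v , x≢v))) (rank-positive x)
    ... | no x≢v   | inj₂ 2≤rk with children 2≤rk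
    ... | a , b , _ , v⋗a , v⋗b , only-a-b with below? (cover⇒rank< v⋗a) | below? (cover⇒rank< v⋗b)
    ... | yes x≼a | _       = yes (≼-trans x≼a (cover⇒≼ v⋗a))
    ... | no _    | yes x≼b = yes (≼-trans x≼b (cover⇒≼ v⋗b))
    ... | no x⋠a  | no x⋠b  = no λ x≼v → ¬¬below-either-child only-a-b (x≼v , x≢v) [ x⋠a , x⋠b ]

  below-child : x ⊏ v → ∃[ c ] (v ⋗ c × x ≼ c)
  below-child {x} x⊏v with children (⊏⇒2≤rank x⊏v)
  ... | a , b , _ , v⋗a , v⋗b , only-a-b with x ≼? a | x ≼? b
  ... | yes x≼a | _       = a , v⋗a , x≼a
  ... | no _    | yes x≼b = b , v⋗b , x≼b
  ... | no x⋠a  | no x⋠b  = ⊥-elim (¬¬below-either-child only-a-b x⊏v [ x⋠a , x⋠b ])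

  descend : ∀ w {i} → 1 ≤ i → i ≤ rk w → ∃[ u ] (u ≼ w × rk u ≡ i)
  descend w {i} 1≤i = rank-rec (λ w → i ≤ rk w → ∃[ u ] (u ≼ w × rk u ≡ i)) go w
    where
    go : ∀ w → (∀ {u} → rk u < rk w → i ≤ rk u → ∃[ u′ ] (u′ ≼ u × rk u′ ≡ i)) →
         i ≤ rk w → ∃[ u ] (u ≼ w × rk u ≡ i)
    go w below i≤rk with rk w ≟ i
    ... | yes rk≡i = w , ≼-refl , rk≡i
    ... | no rk≢i with children (≤-trans (s≤s 1≤i) (≤∧≢⇒< i≤rk (rk≢i ∘ sym)))
    ... | a , _ , _ , w⋗a , _ =
      let (u , u≼a , rk-u) = below (cover⇒rank< w⋗a)
                                   (≤-pred (subst (suc i ≤_) (rank-cover w⋗a) (≤∧≢⇒< i≤rk (rk≢i ∘ sym))))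
      in u , ≼-trans u≼a (cover⇒≼ w⋗a) , rk-u

  max-rank-above : ∀ x → Σ ℕ λ r → MaxRank P rk W r × rk x ≤ r
  max-rank-above x = rk top , ((λ y _ → All.lookup rk≤rk[top] (∈-allFin y)) , inj₂ (top , tt , refl))
                   , All.lookup rk≤rk[top] (∈-allFin x)
    where
    everything = allFin size
    top = argmax rk x everything
    rk≤rk[top] = f[xs]≤f[argmax] {f = rk} x everything

  no-cycle : ∀ i → ¬ Cycle P rk W i
  no-cycle i cycle@(k , xs , _ , 2≤k , _ , steps , _) =
    let (r , max , rk≤r) = max-rank-above (xs 0)
        rk≡i = proj₂ (proj₁ (steps 0 (≤-trans (s≤s z≤n) 2≤k)))
    in proj₂ (proj₂ vine) r max i (subst (1 ≤_) rk≡i (rank-positive (xs 0))) (subst (_≤ r) rk≡i rk≤r) cycle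

  -- A repeated vertex would close a cycle in the forest F_i.
  trail⇒path : (V : Walk x y) → Unique (edges V) → Unique (vertices V)
  trail⇒path []                        _               = [] ∷ []
  trail⇒path (step {x} e x≢y e⋗x e⋗y r) (e∉r ∷ unique) with x ∈? vertices r | trail⇒path r unique
  ... | no x∉r  | path-r = ¬Any⇒All¬ _ x∉r ∷ path-r
  ... | yes x∈r | path-r = ⊥-elim (no-cycle _ (closed-walk⇒cycle cycle unique-sources unique-edges 2≤length))
    where
    cycle = step e x≢y e⋗x e⋗y (prefix r x∈r)
    unique-sources = ¬Any⇒All¬ _ (end∉sources-prefix r path-r x∈r) ∷ Unique-resp-⊑ (prefix-sources r x∈r) path-r
    unique-edges = Unique-resp-⊑ (refl ∷ prefix-edges r x∈r) (e∉r ∷ unique)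
    2≤length = s≤s (nonempty-walk (prefix r x∈r) (x≢y ∘ sym))

  module WithProximity (proximity : Proximity P rk W) where

    common-child : 2 ≤ rk a → a ≢ b → rk a ≡ rk b → v ⋗ a → v ⋗ b → ∃[ w ] (a ⋗ w × b ⋗ w)
    common-child 2≤rk a≢b rk≡ v⋗a v⋗b = proximity _ _ tt tt a≢b rk≡ 2≤rk (_ , v⋗a , v⋗b)

    -- Walk one rank down: c x₀ w₀ x₁ w₁ ⋯ xₖ d, with wⱼ the common child of xⱼ and xⱼ₊₁
    -- given by proximity, and a step dropped whenever its two ends coincide.
    lower-walk : (V : Walk s t) → 2 ≤ rk s → s ⋗ c → t ⋗ d →
                 Σ (Walk c d) λ T → edges T ⊑ vertices V × All (λ u → Any (_≼ u) (vertices T)) (vertices V)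
    lower-walk {c = c} {d} [] _ s⋗c s⋗d with c ≟ᶠ d
    ... | yes refl = [] , minimum _ , here (cover⇒≼ s⋗c) ∷ []
    ... | no c≢d   = step _ c≢d s⋗c s⋗d [] , refl ∷ [] , here (cover⇒≼ s⋗c) ∷ []
    lower-walk {c = c} (step {x} e x≢y e⋗x e⋗y r) 2≤rk x⋗c t⋗d
      with common-child 2≤rk x≢y (rank-siblings e⋗x e⋗y) e⋗x e⋗y
    ... | w , x⋗w , y⋗w
      with lower-walk r (subst (2 ≤_) (rank-siblings e⋗x e⋗y) 2≤rk) y⋗w t⋗d | c ≟ᶠ w
    ... | T , T⊑r , dominated | yes refl =
      T , x ∷ʳ T⊑r , Any-start T (cover⇒≼ x⋗c) ∷ dominated
    ... | T , T⊑r , dominated | no c≢w =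
      step x c≢w x⋗c x⋗w T , refl ∷ T⊑r , here (cover⇒≼ x⋗c) ∷ All.map there dominated

    -- By induction on the rank: the lowered walk joins children of s and t above x, lies below V
    -- vertexwise, and is again a path, since its edges are distinct vertices of V.
    leaf-below-path : (V : Walk s t) → Unique (vertices V) → rk x ≡ 1 → x ≼ s → x ≼ t → All (x ≼_) (vertices V)
    leaf-below-path {s} {x = m} V = rank-rec Q go s V
      where
      Q : El P rk → Set
      Q s = ∀ {t} (V : Walk s t) → Unique (vertices V) → rk m ≡ 1 → m ≼ s → m ≼ t → All (m ≼_) (vertices V)

      go : ∀ s → (∀ {u} → rk u < rk s → Q u) → Q s
      go s below V path rk≡1 m≼s m≼t with rank-one-or-more s
      ... | inj₁ rk-s =
        subst (All (m ≼_)) (sym (path-between-equals V (trans (sym m≡s) m≡t) path)) (m≼s ∷ [])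
        where
        m≡s = ≼∧rank≡⇒≡ m≼s (trans rk≡1 (sym rk-s))
        m≡t = ≼∧rank≡⇒≡ m≼t (trans rk≡1 (sym (trans (walk-rank V) rk-s)))
      ... | inj₂ 2≤rk-s
        with below-child (leaf⊏ rk≡1 2≤rk-s m≼s)
           | below-child (leaf⊏ rk≡1 (subst (2 ≤_) (sym (walk-rank V)) 2≤rk-s) m≼t)
      ... | s′ , s⋗s′ , m≼s′ | t′ , t⋗t′ , m≼t′ with lower-walk V 2≤rk-s s⋗s′ t⋗t′
      ... | T , T⊑V , dominated =
        All.map (λ z≼u → let (m≼z , z≼u) = lookupAny m≼T z≼u in ≼-trans m≼z z≼u) dominated
        where
        m≼T = below (cover⇒rank< s⋗s′) T (trail⇒path T (Unique-resp-⊑ T⊑V path)) rk≡1 m≼s′ m≼t′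

    leaf-below-common-child : a ≢ b → a ⋗ w → b ⋗ w → rk x ≡ 1 → x ≼ a → x ≼ b → x ≼ w
    leaf-below-common-child {a} {b} {w} a≢b a⋗w b⋗w rk≡1 x≼a x≼b
      with below-child (leaf⊏ rk≡1 (⊏⇒2≤rank (cover⇒⊏ a⋗w)) x≼a)
         | below-child (leaf⊏ rk≡1 (⊏⇒2≤rank (cover⇒⊏ b⋗w)) x≼b)
    ... | c , a⋗c , x≼c | d , b⋗d , x≼d with c ≟ᶠ w | d ≟ᶠ w | c ≟ᶠ d
    ... | yes refl | _        | _        = x≼c
    ... | no _     | yes refl | _        = x≼d
    ... | no c≢w   | no _     | yes refl =
      ⊥-elim (a≢b (at-most-one-common-cover c≢w (rank-siblings a⋗c a⋗w) a⋗c a⋗w b⋗d b⋗w))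
    ... | no c≢w   | no d≢w   | no c≢d   =
      All.lookup (leaf-below-path c-a-w-b-d distinct rk≡1 x≼c x≼d) (there (here refl))
      where
      c-a-w-b-d = step a c≢w a⋗c a⋗w (step b (d≢w ∘ sym) b⋗w b⋗d [])
      distinct : Unique (c ∷ w ∷ d ∷ [])
      distinct = (c≢w ∷ c≢d ∷ []) ∷ ((d≢w ∘ sym) ∷ []) ∷ [] ∷ []

    Leaf : El P rk → El P rk → Set
    Leaf v x = rk x ≡ 1 × x ≼ v

    Leaf? : ∀ v → Decidable (Leaf v)
    Leaf? v x = (rk x ≟ 1) ×-dec (x ≼? v)

    #leaves : El P rk → ℕ
    #leaves v = count (Leaf? v) (allFin size)

    #leaves-of-leaf : rk v ≡ 1 → #leaves v ≡ 1
    #leaves-of-leaf {v} rk≡1 =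
      trans (count-≐ (Leaf? v) (_≟ᶠ v) leaves≐v (allFin size)) (count-≟-unique _≟ᶠ_ (allFin⁺ size) (∈-allFin v))
      where
      leaves≐v : Leaf v ≐ (_≡ v)
      leaves≐v = (λ (rk-x , x≼v) → ≼∧rank≡⇒≡ x≼v (trans rk-x (sym rk≡1))) , λ { refl → rk≡1 , ≼-refl }

    leaf-up : u ≼ v → Leaf u x → Leaf v x
    leaf-up u≼v (rk≡1 , x≼u) = rk≡1 , ≼-trans x≼u u≼v

    leaves-of-children : (∀ c → v ⋗ c → c ≡ a ⊎ c ≡ b) → v ⋗ a → v ⋗ b →
                         Leaf v ≐ (λ x → Leaf a x ⊎ Leaf b x)
    leaves-of-children {v} {a} {b} only-a-b v⋗a v⋗b = below-either , [ leaf-up (cover⇒≼ v⋗a) , leaf-up (cover⇒≼ v⋗b) ]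
      where
      below-either : ∀ {x} → Leaf v x → Leaf a x ⊎ Leaf b x
      below-either (rk≡1 , x≼v) with below-child (leaf⊏ rk≡1 (⊏⇒2≤rank (cover⇒⊏ v⋗a)) x≼v)
      ... | c , v⋗c , x≼c =
        [ (λ { refl → inj₁ (rk≡1 , x≼c) }) , (λ { refl → inj₂ (rk≡1 , x≼c) }) ] (only-a-b c v⋗c)

    -- Siblings a, b share exactly the leaves of their common child (proximity), of which by
    -- induction there are rk a − 1; at rank 1 they share none.
    #shared-leaves : a ≢ b → v ⋗ a → v ⋗ b → (∀ {u} → rk u < rk v → #leaves u ≡ rk u) →
                     rk a ≡ suc (count (Leaf? a ∩? Leaf? b) (allFin size))
    #shared-leaves {a} {b} a≢b v⋗a v⋗b #leaves≡rk =
      [ at-rank-one , via-common-child ∘ common-child′ ]′ (rank-one-or-more a)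
      where
      shared-count = count (Leaf? a ∩? Leaf? b) (allFin size)
      common-child′ = λ 2≤rk → common-child 2≤rk a≢b (rank-siblings v⋗a v⋗b) v⋗a v⋗b

      at-rank-one : rk a ≡ 1 → rk a ≡ suc shared-count
      at-rank-one rk-a = trans rk-a (cong suc (sym (count-none (Leaf? a ∩? Leaf? b) disjoint (allFin size))))
        where
        disjoint : ∀ x → ¬ (Leaf a x × Leaf b x)
        disjoint x ((rk≡1 , x≼a) , (_ , x≼b)) =
          a≢b (trans (sym (≼∧rank≡⇒≡ x≼a (trans rk≡1 (sym rk-a))))
                     (≼∧rank≡⇒≡ x≼b (trans rk≡1 (sym (trans (sym (rank-siblings v⋗a v⋗b)) rk-a)))))

      via-common-child : ∃[ w ] (a ⋗ w × b ⋗ w) → rk a ≡ suc shared-count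
      via-common-child (w , a⋗w , b⋗w) = begin
        rk a                ≡⟨ rank-cover a⋗w ⟩
        suc (rk w)          ≡⟨ cong suc (sym (#leaves≡rk (<-trans (cover⇒rank< a⋗w) (cover⇒rank< v⋗a)))) ⟩
        suc (#leaves w)     ≡⟨ cong suc (count-≐ (Leaf? w) (Leaf? a ∩? Leaf? b) shared (allFin size)) ⟩
        suc shared-count    ∎
        where
        open ≡-Reasoning
        shared : Leaf w ≐ (λ x → Leaf a x × Leaf b x)
        shared = (λ leaf → leaf-up (cover⇒≼ a⋗w) leaf , leaf-up (cover⇒≼ b⋗w) leaf)
               , λ ((rk≡1 , x≼a) , (_ , x≼b)) → rk≡1 , leaf-below-common-child a≢b a⋗w b⋗w rk≡1 x≼a x≼b

    -- |L(v)| = |L(a)| + |L(b)| − |L(a) ∩ L(b)| = rk a + rk b − (rk a − 1) = rk v.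
    #leaves≡rank : ∀ v → #leaves v ≡ rk v
    #leaves≡rank = rank-rec (λ v → #leaves v ≡ rk v) go
      where
      go : ∀ v → (∀ {u} → rk u < rk v → #leaves u ≡ rk u) → #leaves v ≡ rk v
      go v #leaves≡rk = [ (λ rk≡1 → trans (#leaves-of-leaf rk≡1) (sym rk≡1)) , from-children ∘ children ]′
                          (rank-one-or-more v)
        where
        from-children : Children v → #leaves v ≡ rk v
        from-children (a , b , a≢b , v⋗a , v⋗b , only-a-b) =
          trans (+-cancelʳ-≡ shared (#leaves v) (suc (rk a)) sum) (sym (rank-cover v⋗a))
          where
          everything = allFin size
          shared = count (Leaf? a ∩? Leaf? b) everything
          sum : #leaves v + shared ≡ suc (rk a) + shared
          sum = begin
            #leaves v + shared                         ≡⟨ cong (_+ shared) (count-≐ (Leaf? v) (Leaf? a ∪? Leaf? b)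
                                                             (leaves-of-children only-a-b v⋗a v⋗b) everything) ⟩
            count (Leaf? a ∪? Leaf? b) everything + shared
                                                       ≡⟨ count-∪+count-∩ (Leaf? a) (Leaf? b) everything ⟩
            #leaves a + #leaves b                      ≡⟨ cong₂ _+_ (#leaves≡rk (cover⇒rank< v⋗a))
                                                                    (#leaves≡rk (cover⇒rank< v⋗b)) ⟩
            rk a + rk b                                ≡⟨ cong (rk a +_) (trans (sym (rank-siblings v⋗a v⋗b))
                                                             (#shared-leaves a≢b v⋗a v⋗b #leaves≡rk)) ⟩
            rk a + suc shared                          ≡⟨ +-suc (rk a) shared ⟩
            suc (rk a) + shared                        ∎
            where open ≡-Reasoning

    ConnectedBelow : El P rk → Set
    ConnectedBelow v = ∀ {x y} → x ≼ v → y ≼ v → rk x ≡ rk y → WalkBelow v x y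

    -- Proximity gives a common child w of c and d; an element u ≼ w of the rank of x links
    -- a walk below c to one below d.
    connect-across-children : (∀ {u} → rk u < rk v → ConnectedBelow u) →
                              v ⋗ c → v ⋗ d → c ≢ d → x ≼ c → y ≼ d → rk x ≡ rk y → WalkBelow v x y
    connect-across-children {v} {c} {d} {x} {y} below v⋗c v⋗d c≢d x≼c y≼d rk≡ with x ≟ᶠ c
    ... | yes refl with ≼∧rank≡⇒≡ y≼d (trans (sym rk≡) (rank-siblings v⋗c v⋗d))
    ... | refl = step v c≢d v⋗c v⋗d [] , ≼-refl ∷ []
    connect-across-children {v} {c} {d} {x} {y} below v⋗c v⋗d c≢d x≼c y≼d rk≡ | no x≢c
      with common-child (⊏⇒2≤rank (x≼c , x≢c)) c≢d (rank-siblings v⋗c v⋗d) v⋗c v⋗d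
    ... | w , c⋗w , d⋗w with descend w (rank-positive x) (⊏∧cover⇒rank≤ (x≼c , x≢c) c⋗w)
    ... | u , u≼w , rk-u =
          WalkBelow-mono (cover⇒≼ v⋗c) (below (cover⇒rank< v⋗c) x≼c u≼c (sym rk-u))
      ++ᴮ WalkBelow-mono (cover⇒≼ v⋗d) (below (cover⇒rank< v⋗d) u≼d y≼d (trans rk-u rk≡))
      where
      u≼c = ≼-trans u≼w (cover⇒≼ c⋗w)
      u≼d = ≼-trans u≼w (cover⇒≼ d⋗w)

    connected-below : ∀ v → ConnectedBelow v
    connected-below = rank-rec ConnectedBelow go
      where
      go : ∀ v → (∀ {u} → rk u < rk v → ConnectedBelow u) → ConnectedBelow v
      go v below {x} {y} x≼v y≼v rk≡ with x ≟ᶠ v | y ≟ᶠ v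
      ... | yes refl | _ with ≼∧rank≡⇒≡ y≼v (sym rk≡)
      ... | refl = [] , []
      go v below {x} {y} x≼v y≼v rk≡ | no x≢v | yes refl = ⊥-elim (<-irrefl rk≡ (rank-mono (x≼v , x≢v)))
      go v below {x} {y} x≼v y≼v rk≡ | no x≢v | no y≢v
        with below-child (x≼v , x≢v) | below-child (y≼v , y≢v)
      ... | c , v⋗c , x≼c | d , v⋗d , y≼d with c ≟ᶠ d
      ... | yes refl = WalkBelow-mono (cover⇒≼ v⋗c) (below (cover⇒rank< v⋗c) x≼c y≼d rk≡)
      ... | no c≢d   = connect-across-children below v⋗c v⋗d c≢d x≼c y≼d rk≡

    connected-ideal : ∀ v i → Connected P rk (Ideal P rk v) i
    connected-ideal v i x y (x≼v , refl) (y≼v , rk-y) =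
      let (V , V≼v) = connected-below v x≼v y≼v (sym rk-y)
      in length (edges V) , vertexAt V , vertexAt-start V , vertexAt-end V , adjacent-along V V≼v

    leaf⇔minimal-ideal : ∀ v x → Leaf v x ⇔ Minimal P rk (Ideal P rk v) x
    leaf⇔minimal-ideal v x =
      mk⇔ (λ (rk≡1 , x≼v) → x≼v , λ y _ y⊏x → <⇒≱ (subst (rk y <_) rk≡1 (rank-mono y⊏x)) (rank-positive y))
          (λ min → rank-minimal (minimal-ideal⇒minimal min) , proj₁ min)

    dim-ideal : ∀ v → Dim P rk (Ideal P rk v) (rk v)
    dim-ideal v =
        filter (Leaf? v) (allFin size) , filter⁺ (Leaf? v) (allFin⁺ size)
      , (λ x → mk⇔ (to (leaf⇔minimal-ideal v x) ∘ proj₂ ∘ ∈-filter⁻ (Leaf? v) {xs = allFin size})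
                   (∈-filter⁺ (Leaf? v) (∈-allFin x) ∘ from (leaf⇔minimal-ideal v x)))
      , #leaves≡rank v
      where open Equivalence

    forest-ideal : ∀ v i → Forest P rk (Ideal P rk v) i
    forest-ideal v i = no-cycle i ∘ cycle-ideal⇒cycle

    proximity⇒LRVine : IsLRVine P rk
    proximity⇒LRVine v =
        (graded-ideal (proj₁ vine) v , vineCond1-ideal (proj₁ (proj₂ vine)) v , λ _ _ i _ _ → forest-ideal v i)
      , (rk v , maxRank-ideal v , dim-ideal v , λ i _ _ → forest-ideal v i , connected-ideal v i)
      , proximity-ideal proximity v

proposition4p4 : (P : FinPoset) (rk : Fin (FinPoset.size P) → ℕ) →
    IsVine P rk (Whole P rk) →
    IsLRVine P rk ⇔ Proximity P rk (Whole P rk)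
proposition4p4 P rk vine = mk⇔ (Ideals.LRVine⇒proximity P rk) (Vine.WithProximity.proximity⇒LRVine P rk vine)
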